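{- Let $G,G'$ be games over a poset $A$, and let $H$ be a passable game over a poset $B$. Then: (a) if $G\triangleright G'$ then $G+H\triangleright G'+H$; (b) if $G\le G'$ then $G+H\le G'+H$.
   Context: Games over a poset $A$: $[a]$ atomic for $a\in A$; $\{L\mid R\}$ composite for non-empty sets $L,R$ of games (left and right options); atomic games have no options. $G\le H$ iff (1) every $G^L\triangleright H$, (2) every right option $H^R$ of $H$ has $G\triangleright H^R$, (3) if $G$ or $H$ atomic then $G\triangleright H$; $G\triangleright H$ iff (1) some $G^R\le H$, or (2) some left option $H^L$ of $H$ with $G\le H^L$, or (3) $G=[a],H=[b]$ atomic, $a\le b$. $G$ is passable if $G\triangleright G$ and all options of $G$ are passable (recursively). Sum: for $G$ over $A$ and $H$ over $B$, $G+H$ is the game over $A\times B$ (ordered componentwise) defined recursively by $[a]+[b]=[(a,b)]$ when both are atomic, and otherwise $G+H=\{G^L+H,\,G+H^L\mid G^R+H,\,G+H^R\}$, where $G^L,G^R,H^L,H^R$ range over the options of $G$ and $H$ (an atomic summand contributes no options). -}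

module Defs where

open import Level using (0ℓ)
open import Data.Empty using (⊥)
open import Data.Unit using (⊤)
import Data.Sum
open import Data.Sum using (_⊎_; inj₁; inj₂)
open import Data.Product using (_×_; _,_)
open import Relation.Binary.Bundles using (Poset)
open import Data.Product.Relation.Binary.Pointwise.NonDependent using (×-poset)

-- A composite game {L | R} is given by non-empty families of options:
-- an index type for each side, a witness of non-emptiness, and the options.
data Game (A : Set) : Set₁ where
  atom : A → Game A
  comp : (I : Set) → I → (I → Game A) →
         (J : Set) → J → (J → Game A) → Game A

module _ {A : Set} where

  LIx : Game A → Set
  LIx (atom _) = ⊥
  LIx (comp I _ _ _ _ _) = I

  RIx : Game A → Set
  RIx (atom _) = ⊥
  RIx (comp _ _ _ J _ _) = J

  lopt : (G : Game A) → LIx G → Game A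
  lopt (atom _) ()
  lopt (comp _ _ L _ _ _) i = L i

  ropt : (G : Game A) → RIx G → Game A
  ropt (atom _) ()
  ropt (comp _ _ _ _ _ R) j = R j

  IsAtomic : Game A → Set
  IsAtomic (atom _) = ⊤
  IsAtomic (comp _ _ _ _ _ _) = ⊥

-- The relations ≤ and ▷ on games over a poset P (mutual inductive definition;
-- since games are well-founded this is the recursive definition of the paper).
module Order (P : Poset 0ℓ 0ℓ 0ℓ) where
  open Poset P renaming (Carrier to A; _≤_ to _≤A_)

  data _▷_ : Game A → Game A → Set₁
  data _≤G_ : Game A → Game A → Set₁

  data _≤G_ where
    le : ∀ {G H} →
         (∀ i → lopt G i ▷ H) →
         (∀ j → G ▷ ropt H j) →
         (IsAtomic G ⊎ IsAtomic H → G ▷ H) →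
         G ≤G H

  data _▷_ where
    ▷-right : ∀ {G H} (i : RIx G) → ropt G i ≤G H → G ▷ H
    ▷-left  : ∀ {G H} (j : LIx H) → G ≤G lopt H j → G ▷ H
    ▷-atom  : ∀ {a b} → a ≤A b → atom a ▷ atom b

  Passable : Game A → Set₁
  Passable G@(atom _) = G ▷ G
  Passable G@(comp I _ L J _ R) =
    (G ▷ G) × ((i : I) → Passable (L i)) × ((j : J) → Passable (R j))

-- Sum of games: G over A, H over B gives G + H over A × B.
-- [a] + [b] = [(a,b)]; otherwise G + H = {G^L+H, G+H^L | G^R+H, G+H^R}
-- (an atomic summand contributes no options).
_+G_ : {A B : Set} → Game A → Game B → Game (A × B)
plusA : {A B : Set} → A → Game B → Game (A × B)
plusC : {A B : Set} (I : Set) → I → (I → Game A) →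
        (J : Set) → J → (J → Game A) → Game B → Game (A × B)

atom a +G H = plusA a H
comp I i L J j R +G H = plusC I i L J j R H

plusA a (atom b) = atom (a , b)
plusA a (comp I i L J j R) =
  comp I i (λ k → plusA a (L k)) J j (λ k → plusA a (R k))

plusC I i L J j R (atom b) =
  comp I i (λ k → L k +G atom b) J j (λ k → R k +G atom b)
plusC I i L J j R (comp I' i' L' J' j' R') =
  comp (I ⊎ I') (inj₁ i) (Data.Sum.[ (λ k → L k +G comp I' i' L' J' j' R')
                                   , (λ k → plusC I i L J j R (L' k)) ])
       (J ⊎ J') (inj₁ j) (Data.Sum.[ (λ k → R k +G comp I' i' L' J' j' R')
                                   , (λ k → plusC I i L J j R (R' k)) ])

_×P_ : Poset 0ℓ 0ℓ 0ℓ → Poset 0ℓ 0ℓ 0ℓ → Poset 0ℓ 0ℓ 0ℓ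
P ×P Q = ×-poset P Q

-- Induction on the derivation of G ▷ G' or G ≤ G', with an inner induction
-- on H for ≤.  The options of G + H are G^L + H and G + H^L (likewise on the
-- right): the former are handled by the induction on the derivation, the latter
-- by the induction on H with the same derivation.  The only base case,
-- [a] ▷ [b] with a ≤ b, needs [a] + H ▷ [b] + H; it follows from H ▷ H because
-- [a] + – is monotone for ≤ and ▷.  This is where passability of H, and through
-- the inner induction of its options, is used.
module Submission where

open import Defs
open import Data.Product using (_×_; _,_; ∃; proj₁)
open import Data.Sum using (inj₁; inj₂; [_,_])
import Data.Sum as Sum
open import Data.Unit using (tt)
open import Relation.Binary.Bundles using (Poset)
open import Relation.Binary.PropositionalEquality using (_≡_; refl)
open import Level using (0ℓ)

module _ {A B : Set} where

  lopt-+G-elim : (G : Game A) (H : Game B) (Pr : Game (A × B) → Set₁) →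
                 (∀ i → Pr (lopt G i +G H)) → (∀ k → Pr (G +G lopt H k)) →
                 ∀ k → Pr (lopt (G +G H) k)
  lopt-+G-elim (atom _)           (atom _)           Pr f g ()
  lopt-+G-elim (atom _)           (comp _ _ _ _ _ _) Pr f g k = g k
  lopt-+G-elim (comp _ _ _ _ _ _) (atom _)           Pr f g i = f i
  lopt-+G-elim (comp _ _ _ _ _ _) (comp _ _ _ _ _ _) Pr f g = [ f , g ]

  ropt-+G-elim : (G : Game A) (H : Game B) (Pr : Game (A × B) → Set₁) →
                 (∀ i → Pr (ropt G i +G H)) → (∀ k → Pr (G +G ropt H k)) →
                 ∀ k → Pr (ropt (G +G H) k)
  ropt-+G-elim (atom _)           (atom _)           Pr f g ()
  ropt-+G-elim (atom _)           (comp _ _ _ _ _ _) Pr f g k = g k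
  ropt-+G-elim (comp _ _ _ _ _ _) (atom _)           Pr f g i = f i
  ropt-+G-elim (comp _ _ _ _ _ _) (comp _ _ _ _ _ _) Pr f g = [ f , g ]

  lopt-+Gˡ : (G : Game A) (H : Game B) (i : LIx G) →
             ∃ λ k → lopt (G +G H) k ≡ lopt G i +G H
  lopt-+Gˡ (comp _ _ _ _ _ _) (atom _)           i = i , refl
  lopt-+Gˡ (comp _ _ _ _ _ _) (comp _ _ _ _ _ _) i = inj₁ i , refl

  ropt-+Gˡ : (G : Game A) (H : Game B) (i : RIx G) →
             ∃ λ k → ropt (G +G H) k ≡ ropt G i +G H
  ropt-+Gˡ (comp _ _ _ _ _ _) (atom _)           i = i , refl
  ropt-+Gˡ (comp _ _ _ _ _ _) (comp _ _ _ _ _ _) i = inj₁ i , refl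

  lopt-+Gʳ : (G : Game A) (H : Game B) (k : LIx H) →
             ∃ λ k' → lopt (G +G H) k' ≡ G +G lopt H k
  lopt-+Gʳ (atom _)           (comp _ _ _ _ _ _) k = k , refl
  lopt-+Gʳ (comp _ _ _ _ _ _) (comp _ _ _ _ _ _) k = inj₂ k , refl

  ropt-+Gʳ : (G : Game A) (H : Game B) (k : RIx H) →
             ∃ λ k' → ropt (G +G H) k' ≡ G +G ropt H k
  ropt-+Gʳ (atom _)           (comp _ _ _ _ _ _) k = k , refl
  ropt-+Gʳ (comp _ _ _ _ _ _) (comp _ _ _ _ _ _) k = inj₂ k , refl

  IsAtomic-+Gˡ : (G : Game A) (H : Game B) → IsAtomic (G +G H) → IsAtomic G
  IsAtomic-+Gˡ (atom _)           (atom _)           _  = tt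
  IsAtomic-+Gˡ (atom _)           (comp _ _ _ _ _ _) ()
  IsAtomic-+Gˡ (comp _ _ _ _ _ _) (atom _)           ()
  IsAtomic-+Gˡ (comp _ _ _ _ _ _) (comp _ _ _ _ _ _) ()

  IsAtomic-+Gʳ : (G : Game A) (H : Game B) → IsAtomic (G +G H) → IsAtomic H
  IsAtomic-+Gʳ (atom _)           (atom _)           _  = tt
  IsAtomic-+Gʳ (atom _)           (comp _ _ _ _ _ _) ()
  IsAtomic-+Gʳ (comp _ _ _ _ _ _) (atom _)           ()
  IsAtomic-+Gʳ (comp _ _ _ _ _ _) (comp _ _ _ _ _ _) ()

module OrderProperties (P : Poset 0ℓ 0ℓ 0ℓ) where
  open Poset P using () renaming (Carrier to A)
  open Order P

  ▷-right-∃ : ∀ {G H K : Game A} → (∃ λ i → ropt G i ≡ K) → K ≤G H → G ▷ H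
  ▷-right-∃ (i , refl) = ▷-right i

  ▷-left-∃ : ∀ {G H K : Game A} → (∃ λ j → lopt H j ≡ K) → G ≤G K → G ▷ H
  ▷-left-∃ (j , refl) = ▷-left j

  passable⇒▷-refl : ∀ {H : Game A} → Passable H → H ▷ H
  passable⇒▷-refl {atom _}           p = p
  passable⇒▷-refl {comp _ _ _ _ _ _} p = proj₁ p

module SumMonotonicity (P Q : Poset 0ℓ 0ℓ 0ℓ) where
  open Poset P using () renaming (Carrier to A; _≤_ to _≤A_)
  open Poset Q using () renaming (Carrier to B)
  module OP = Order P
  module OQ = Order Q
  open Order (P ×P Q)
  open OrderProperties (P ×P Q) using (▷-right-∃; ▷-left-∃)
  open OrderProperties Q using (passable⇒▷-refl)

  atom-+G-mono-≤ : ∀ {a b} {X Y : Game B} → a ≤A b → X OQ.≤G Y →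
                   (atom a +G X) ≤G (atom b +G Y)
  atom-+G-mono-▷ : ∀ {a b} {X Y : Game B} → a ≤A b → X OQ.▷ Y →
                   (atom a +G X) ▷ (atom b +G Y)

  atom-+G-mono-≤ {a} {b} {X} {Y} a≤b (OQ.le f g h) =
    le (lopt-+G-elim (atom a) X (_▷ (atom b +G Y)) (λ ())
          (λ k → atom-+G-mono-▷ a≤b (f k)))
       (ropt-+G-elim (atom b) Y ((atom a +G X) ▷_) (λ ())
          (λ k → atom-+G-mono-▷ a≤b (g k)))
       (λ at → atom-+G-mono-▷ a≤b (h (Sum.map (IsAtomic-+Gʳ (atom a) X)
                                               (IsAtomic-+Gʳ (atom b) Y) at)))

  atom-+G-mono-▷ {a} {X = X} a≤b (OQ.▷-right i p) =
    ▷-right-∃ (ropt-+Gʳ (atom a) X i) (atom-+G-mono-≤ a≤b p)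
  atom-+G-mono-▷ {b = b} {Y = Y} a≤b (OQ.▷-left j p) =
    ▷-left-∃ (lopt-+Gʳ (atom b) Y j) (atom-+G-mono-≤ a≤b p)
  atom-+G-mono-▷ a≤b (OQ.▷-atom c≤d) = ▷-atom (a≤b , c≤d)

  +G-monoˡ-▷ : ∀ {G G' : Game A} (H : Game B) → OQ.Passable H →
               G OP.▷ G' → (G +G H) ▷ (G' +G H)
  +G-monoˡ-≤ : ∀ {G G' : Game A} (H : Game B) → OQ.Passable H →
               G OP.≤G G' → (G +G H) ≤G (G' +G H)

  +G-monoˡ-▷ H pH (OP.▷-atom a≤b) = atom-+G-mono-▷ a≤b (passable⇒▷-refl pH)
  +G-monoˡ-▷ {G} H pH (OP.▷-right i p) =
    ▷-right-∃ (ropt-+Gˡ G H i) (+G-monoˡ-≤ H pH p)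
  +G-monoˡ-▷ {G' = G'} H pH (OP.▷-left j p) =
    ▷-left-∃ (lopt-+Gˡ G' H j) (+G-monoˡ-≤ H pH p)

  +G-monoˡ-≤ {G} {G'} H@(atom _) pH (OP.le f g h) =
    le (lopt-+G-elim G H (_▷ (G' +G H)) (λ i → +G-monoˡ-▷ H pH (f i)) (λ ()))
       (ropt-+G-elim G' H ((G +G H) ▷_) (λ i → +G-monoˡ-▷ H pH (g i)) (λ ()))
       (λ at → +G-monoˡ-▷ H pH (h (Sum.map (IsAtomic-+Gˡ G H) (IsAtomic-+Gˡ G' H) at)))
  +G-monoˡ-≤ {G} {G'} H@(comp _ _ L _ _ R) pH@(_ , pL , pR) G≤G'@(OP.le f g h) =
    le (lopt-+G-elim G H (_▷ (G' +G H)) (λ i → +G-monoˡ-▷ H pH (f i))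
          (λ k → ▷-left-∃ (lopt-+Gʳ G' H k) (+G-monoˡ-≤ (L k) (pL k) G≤G')))
       (ropt-+G-elim G' H ((G +G H) ▷_) (λ i → +G-monoˡ-▷ H pH (g i))
          (λ k → ▷-right-∃ (ropt-+Gʳ G H k) (+G-monoˡ-≤ (R k) (pR k) G≤G')))
       (λ at → +G-monoˡ-▷ H pH (h (Sum.map (IsAtomic-+Gˡ G H) (IsAtomic-+Gˡ G' H) at)))

proposition8p4 : (P Q : Poset 0ℓ 0ℓ 0ℓ) →
    (G G' : Game (Poset.Carrier P)) → (H : Game (Poset.Carrier Q)) →
    Order.Passable Q H →
    (Order._▷_ P G G' → Order._▷_ (P ×P Q) (G +G H) (G' +G H)) ×
    (Order._≤G_ P G G' → Order._≤G_ (P ×P Q) (G +G H) (G' +G H))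
proposition8p4 P Q G G' H pH = +G-monoˡ-▷ H pH , +G-monoˡ-≤ H pH
  where open SumMonotonicity P Q
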